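{- As formal power series in $q$, $$\sum_{n\geq 0}M_n(u_1,u_2,u_3;v_1,v_2;t)q^n=\frac{t^{ -1}-v_1q+(u_3-u_1)q^2-\sqrt{t^{ -2}-2t^{ -1}v_1q+(v_1^2-2t^{ -1}(u_1+u_3))q^2+(2u_1v_1+2u_3v_1-4u_2v_2)q^3+(u_1-u_3)^2q^4}}{2q^2},$$ where the square root is the power series in $q$ with constant term $t^{ -1}$.
   Context: A plane tree is an unlabeled rooted tree in which the children of every vertex are linearly ordered. A leaf is a vertex with no children, an interior vertex one with at least one child. A tip-augmented plane tree is a plane tree in which the leftmost child of every interior vertex is a leaf; $\mathcal T_m$ is the set of tip-augmented plane trees with $m$ edges. In such a tree: a leaf without siblings is a singleton leaf; a leaf with siblings that is the leftmost child of its parent is an elder twin leaf if the second child of its parent is a leaf, and an elder non-twin leaf otherwise; a leaf with siblings that is the second child is a second leaf; a leaf with siblings that is neither first nor second child is a younger leaf. An edge is a young edge if its lower endpoint is not a singleton, elder twin or elder non-twin leaf. Let $\mathrm{sleaf},\mathrm{etleaf},\mathrm{entleaf},\mathrm{syleaf},\mathrm{yerleaf},\mathrm{yedge}$ count singleton, elder twin, elder non-twin, second and younger leaves and young edges. For $n\ge1$, $M_n(u_1,u_2,u_3;v_1,v_2;t)=\sum_{T\in\mathcal T_{n+1}}u_1^{\mathrm{sleaf}(T)}u_2^{\mathrm{etleaf}(T)}u_3^{\mathrm{entleaf}(T)}v_1^{\mathrm{yerleaf}(T)}v_2^{\mathrm{syleaf}(T)}t^{\mathrm{yedge}(T)}$,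 and by convention $M_0(u_1,u_2,u_3;v_1,v_2;t)=u_3$. -}

module Defs where

open import Level using (Level)
open import Data.Bool using (Bool; true; false; if_then_else_; _∧_)
open import Data.Nat using (ℕ; zero; suc; _∸_)
open import Data.List using (List; []; _∷_; map; concatMap; upTo; filterᵇ; foldr; length)
open import Algebra.Bundles using (CommutativeRing)

data PTree : Set where
  node : List PTree → PTree

isLeaf : PTree → Bool
isLeaf (node []) = true
isLeaf (node (_ ∷ _)) = false

mutual
  edges : PTree → ℕ
  edges (node cs) = length cs Data.Nat.+ edgesF cs

  edgesF : List PTree → ℕ
  edgesF [] = 0
  edgesF (c ∷ cs) = edges c Data.Nat.+ edgesF cs

mutual
  tipAug : PTree → Bool
  tipAug (node []) = true
  tipAug (node (c ∷ cs)) = isLeaf c ∧ tipAugF (c ∷ cs)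

  tipAugF : List PTree → Bool
  tipAugF [] = true
  tipAugF (c ∷ cs) = tipAug c ∧ tipAugF cs

-- Enumeration of all plane forests / trees with a given number of edges.
-- forestsF fuel k : all lists of plane trees with k edges in total
-- (a forest (node c ∷ r) has 1 + edges(c) + edges(r) edges);
-- correct whenever fuel ≥ k.

forestsF : ℕ → ℕ → List (List PTree)
forestsF _ zero = [] ∷ []
forestsF zero (suc k) = []
forestsF (suc f) (suc k) =
  concatMap (λ j → concatMap (λ c → map (λ r → node c ∷ r) (forestsF f (k ∸ j)))
                              (forestsF f j))
            (upTo (suc k))

planeTrees : ℕ → List PTree
planeTrees m = map node (forestsF m m)

tipTrees : ℕ → List PTree
tipTrees m = filterᵇ tipAug (planeTrees m)

-- Statistics: singleton leaves, elder twin leaves, elder non-twin leaves,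
-- second leaves, younger leaves, young edges.

record Stats : Set where
  constructor stats
  field
    sleaf etleaf entleaf syleaf yerleaf yedge : ℕ

open Stats public

infixl 6 _⊞_
_⊞_ : Stats → Stats → Stats
stats a b c d e f ⊞ stats a' b' c' d' e' f' =
  stats (a Data.Nat.+ a') (b Data.Nat.+ b') (c Data.Nat.+ c')
        (d Data.Nat.+ d') (e Data.Nat.+ e') (f Data.Nat.+ f')

zeroS : Stats
zeroS = stats 0 0 0 0 0 0

b2n : Bool → ℕ
b2n true = 1
b2n false = 0

-- The edge to a child
-- is young iff that child is not a singleton / elder twin / elder
-- non-twin leaf, i.e. iff it is not a leaf in first position.
youngerChildren : List PTree → Stats
youngerChildren [] = zeroS
youngerChildren (c ∷ cs) = stats 0 0 0 0 (b2n (isLeaf c)) 1 ⊞ youngerChildren cs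

childStats : List PTree → Stats
childStats [] = zeroS
childStats (c ∷ []) =
  if isLeaf c then stats 1 0 0 0 0 0 else stats 0 0 0 0 0 1
childStats (c₁ ∷ c₂ ∷ cs) =
  (if isLeaf c₁
     then (if isLeaf c₂ then stats 0 1 0 0 0 0 else stats 0 0 1 0 0 0)
     else stats 0 0 0 0 0 1)
  ⊞ stats 0 0 0 (b2n (isLeaf c₂)) 0 1
  ⊞ youngerChildren cs

mutual
  treeStats : PTree → Stats
  treeStats (node cs) = childStats cs ⊞ forestStats cs

  forestStats : List PTree → Stats
  forestStats [] = zeroS
  forestStats (c ∷ cs) = treeStats c ⊞ forestStats cs

module Series {c ℓ : Level} (R : CommutativeRing c ℓ) where
  open CommutativeRing R

  infixl 6 _−_
  _−_ : Carrier → Carrier → Carrier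
  x − y = x + (- y)

  pow : Carrier → ℕ → Carrier
  pow x zero = 1#
  pow x (suc n) = x * pow x n

  two : Carrier
  two = 1# + 1#

  four : Carrier
  four = two + two

  sumR : List Carrier → Carrier
  sumR = foldr _+_ 0#

  PS : Set c
  PS = ℕ → Carrier

  poly : List Carrier → PS
  poly [] n = 0#
  poly (a ∷ as) zero = a
  poly (a ∷ as) (suc n) = poly as n

  _⊕_ : PS → PS → PS
  (f ⊕ g) n = f n + g n

  _⊖_ : PS → PS → PS
  (f ⊖ g) n = f n − g n

  _·_ : Carrier → PS → PS
  (a · f) n = a * f n

  qmul : PS → PS
  qmul f zero = 0#
  qmul f (suc n) = f n

  _⊛_ : PS → PS → PS
  (f ⊛ g) n = sumR (map (λ i → f i * g (n ∸ i)) (upTo (suc n)))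

  module _ (u₁ u₂ u₃ v₁ v₂ t : Carrier) where

    weight : PTree → Carrier
    weight T =
      pow u₁ (sleaf s) * pow u₂ (etleaf s) * pow u₃ (entleaf s)
        * pow v₁ (yerleaf s) * pow v₂ (syleaf s) * pow t (yedge s)
      where s = treeStats T

    -- M_n(u₁,u₂,u₃;v₁,v₂;t), with the convention M_0 = u₃
    M : ℕ → Carrier
    M zero = u₃
    M (suc n) = sumR (map weight (tipTrees (suc (suc n))))

{-# OPTIONS --safe #-}
module Submission where

-- Cut a tip-augmented tree at the root: its children are a leading leaf followed by a list
-- of siblings, and every later child is a leaf or again a tip-augmented tree. Counting children
-- lists by edges, the generating functions K (siblings of the leading leaf) and Z (children from
-- the third on) satisfy Z = 1 + t q (v₁ + q K) Z and K = u₁ + q (u₂ t v₂ + u₃ t q K) Z, while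
-- F = M equals K + u₃ - u₁. Eliminating Z gives F = (u₃ + c′ q) Z with c′ = t (u₂ v₂ - u₃ v₁),
-- hence F = u₃ + c′ q + t v₁ q F + t q² K F, i.e. the quadratic q² F² - A F + t⁻¹ (u₃ + c′ q) = 0
-- with A = t⁻¹ - v₁ q + (u₃ - u₁) q². Completing the square, (A - 2 q² F)² = A² - 4 q² t⁻¹ (u₃ + c′ q),
-- which is the stated polynomial.

open import Defs
open import Data.Nat using (ℕ)
open import Data.List using (List; []; _∷_)
open import Data.Product using (_×_; _,_)
open import Algebra.Bundles using (CommutativeRing)
open import Level using (Level)

open import Algebra.Solver.Ring.AlmostCommutativeRing using (fromCommutativeRing; _-Raw-AlmostCommutative⟶_)
open import Data.Bool using (Bool; true; false; _∧_; if_then_else_)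
open import Data.List using (_++_; map; concat; concatMap; filterᵇ; upTo; applyUpTo)
open import Data.List.Properties using (map-upTo; map-cong-local)
open import Data.List.Relation.Unary.All.Properties using (applyUpTo⁺₁)
open import Data.Maybe using (Maybe; just; nothing)
open import Data.Nat as ℕ using (zero; suc; _∸_; _≤_; _<_; z≤n; s≤s)
import Data.Nat.Properties as ℕ
import Data.Integer as ℤ
open import Data.Integer using (+_; -[1+_])
open import Data.Integer.Properties using ([1+m]⊖[1+n]≡m⊖n)
open import Data.Sign as Sign using (Sign)
open import Function using (id)
open import Relation.Nullary using (yes; no)
import Relation.Binary.PropositionalEquality as ≡

forestsF-fuel : ∀ {f f′} k → k ≤ f → k ≤ f′ → forestsF f k ≡.≡ forestsF f′ k
forestsF-fuel zero _ _ = ≡.refl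
forestsF-fuel {suc f} {suc f′} (suc k) (s≤s k≤f) (s≤s k≤f′) =
  ≡.cong concat (map-cong-local (applyUpTo⁺₁ id (suc k) same-split))
  where
  same-split : ∀ {j} → j < suc k →
    concatMap (λ c → map (λ r → node c ∷ r) (forestsF f (k ∸ j))) (forestsF f j) ≡.≡
    concatMap (λ c → map (λ r → node c ∷ r) (forestsF f′ (k ∸ j))) (forestsF f′ j)
  same-split {j} (s≤s j≤k) =
    ≡.cong₂ (λ rs cs → concatMap (λ c → map (λ r → node c ∷ r) rs) cs)
      (forestsF-fuel (k ∸ j) (ℕ.≤-trans (ℕ.m∸n≤m k j) k≤f) (ℕ.≤-trans (ℕ.m∸n≤m k j) k≤f′))
      (forestsF-fuel j (ℕ.≤-trans j≤k k≤f) (ℕ.≤-trans j≤k k≤f′))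

module IntegerCoefficients {c ℓ} (R : CommutativeRing c ℓ) where
  open CommutativeRing R
  open ℤ using (ℤ; _⊖_; _◃_)
  open import Algebra.Properties.Ring ring using (-‿involutive; -0#≈0#; -1*x≈-x)
  open import Algebra.Properties.AbelianGroup +-abelianGroup using (⁻¹-∙-comm)
  open import Algebra.Properties.CommutativeSemigroup +-commutativeSemigroup using () renaming (interchange to +-interchange)
  open import Algebra.Properties.CommutativeSemigroup *-commutativeSemigroup using () renaming (interchange to *-interchange)
  open import Algebra.Properties.Semiring.Mult.TCOptimised semiring using (1+×; ×-homo-+; ×1-homo-*) renaming (_×_ to _×ᴿ_)
  open import Relation.Binary.Reasoning.Setoid setoid

  -- With the type-checking-optimised multiples, ι (+ 1) is 1# and ι (+ 2) is 1# + 1# definitionally,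
  -- which is what lets `solve` match goals written with 1# and two.
  ι : ℤ → Carrier
  ι (+ n) = n ×ᴿ 1#
  ι -[1+ n ] = - (suc n ×ᴿ 1#)

  ι-⊖ : ∀ m n → ι (m ⊖ n) ≈ m ×ᴿ 1# - n ×ᴿ 1#
  ι-⊖ m zero = begin
    m ×ᴿ 1#       ≈⟨ +-identityʳ _ ⟨
    m ×ᴿ 1# + 0#  ≈⟨ +-congˡ -0#≈0# ⟨
    m ×ᴿ 1# - 0#  ∎
  ι-⊖ zero (suc n) = sym (+-identityˡ _)
  ι-⊖ (suc m) (suc n) = begin
    ι (suc m ⊖ suc n)                  ≡⟨ ≡.cong ι ([1+m]⊖[1+n]≡m⊖n m n) ⟩
    ι (m ⊖ n)                          ≈⟨ ι-⊖ m n ⟩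
    m ×ᴿ 1# - n ×ᴿ 1#                  ≈⟨ +-identityˡ _ ⟨
    0# + (m ×ᴿ 1# - n ×ᴿ 1#)           ≈⟨ +-congʳ (-‿inverseʳ 1#) ⟨
    (1# - 1#) + (m ×ᴿ 1# - n ×ᴿ 1#)    ≈⟨ +-interchange _ _ _ _ ⟩
    (1# + m ×ᴿ 1#) + (- 1# - n ×ᴿ 1#)  ≈⟨ +-congˡ (⁻¹-∙-comm 1# (n ×ᴿ 1#)) ⟩
    (1# + m ×ᴿ 1#) - (1# + n ×ᴿ 1#)    ≈⟨ +-cong (1+× m 1#) (-‿cong (1+× n 1#)) ⟨
    suc m ×ᴿ 1# - suc n ×ᴿ 1#          ∎

  ι-+ : ∀ i j → ι (i ℤ.+ j) ≈ ι i + ι j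
  ι-+ -[1+ m ] -[1+ n ] = begin
    - (suc (suc (m ℕ.+ n)) ×ᴿ 1#)    ≡⟨ ≡.cong (λ k → - (suc k ×ᴿ 1#)) (ℕ.+-suc m n) ⟨
    - ((suc m ℕ.+ suc n) ×ᴿ 1#)      ≈⟨ -‿cong (×-homo-+ 1# (suc m) (suc n)) ⟩
    - (suc m ×ᴿ 1# + suc n ×ᴿ 1#)    ≈⟨ ⁻¹-∙-comm _ _ ⟨
    - (suc m ×ᴿ 1#) - (suc n ×ᴿ 1#)  ∎
  ι-+ -[1+ m ] (+ n) = trans (ι-⊖ n (suc m)) (+-comm _ _)
  ι-+ (+ m) -[1+ n ] = ι-⊖ m (suc n)
  ι-+ (+ m) (+ n) = ×-homo-+ 1# m n

  σ : Sign → Carrier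
  σ Sign.+ = 1#
  σ Sign.- = - 1#

  σ-* : ∀ s s′ → σ (s Sign.* s′) ≈ σ s * σ s′
  σ-* Sign.+ s′ = sym (*-identityˡ _)
  σ-* Sign.- Sign.+ = sym (*-identityʳ _)
  σ-* Sign.- Sign.- = sym (trans (-1*x≈-x _) (-‿involutive _))

  ι-◃ : ∀ s n → ι (s ◃ n) ≈ σ s * n ×ᴿ 1#
  ι-◃ s zero = sym (zeroʳ _)
  ι-◃ Sign.+ (suc n) = sym (*-identityˡ _)
  ι-◃ Sign.- (suc n) = sym (-1*x≈-x _)

  ι≈σ*∣∣ : ∀ i → ι i ≈ σ (ℤ.sign i) * ℤ.∣ i ∣ ×ᴿ 1#
  ι≈σ*∣∣ (+ n) = sym (*-identityˡ _)
  ι≈σ*∣∣ -[1+ n ] = sym (-1*x≈-x _)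

  ι-* : ∀ i j → ι (i ℤ.* j) ≈ ι i * ι j
  ι-* i j = begin
    ι (ℤ.sign i Sign.* ℤ.sign j ◃ ℤ.∣ i ∣ ℕ.* ℤ.∣ j ∣)
      ≈⟨ ι-◃ (ℤ.sign i Sign.* ℤ.sign j) (ℤ.∣ i ∣ ℕ.* ℤ.∣ j ∣) ⟩
    σ (ℤ.sign i Sign.* ℤ.sign j) * (ℤ.∣ i ∣ ℕ.* ℤ.∣ j ∣) ×ᴿ 1#
      ≈⟨ *-cong (σ-* (ℤ.sign i) (ℤ.sign j)) (×1-homo-* ℤ.∣ i ∣ ℤ.∣ j ∣) ⟩
    (σ (ℤ.sign i) * σ (ℤ.sign j)) * (ℤ.∣ i ∣ ×ᴿ 1# * ℤ.∣ j ∣ ×ᴿ 1#)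
      ≈⟨ *-interchange _ _ _ _ ⟩
    (σ (ℤ.sign i) * ℤ.∣ i ∣ ×ᴿ 1#) * (σ (ℤ.sign j) * ℤ.∣ j ∣ ×ᴿ 1#)
      ≈⟨ *-cong (ι≈σ*∣∣ i) (ι≈σ*∣∣ j) ⟨
    ι i * ι j ∎

  ι-neg : ∀ i → ι (ℤ.- i) ≈ - ι i
  ι-neg -[1+ n ] = sym (-‿involutive _)
  ι-neg (+ zero) = sym -0#≈0#
  ι-neg (+ suc n) = refl

  homomorphism : ℤ.+-*-rawRing -Raw-AlmostCommutative⟶ fromCommutativeRing R
  homomorphism = record
    { ⟦_⟧ = ι ; +-homo = ι-+ ; *-homo = ι-* ; -‿homo = ι-neg ; 0-homo = refl ; 1-homo = refl }

  ι-equal? : ∀ i j → Maybe (ι i ≈ ι j)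
  ι-equal? i j with i ℤ.≟ j
  ... | yes ≡.refl = just refl
  ... | no _     = nothing

  open import Algebra.Solver.Ring ℤ.+-*-rawRing (fromCommutativeRing R) homomorphism ι-equal? public
    using (solve; _:=_; _:+_; _:*_; _:-_; :-_; _:^_; con; Polynomial)

module _ {c ℓ} (R : CommutativeRing c ℓ) where
  open CommutativeRing R
  open Series R
  open IntegerCoefficients R
  open import Algebra.Properties.Ring ring using (-‿distribˡ-*)
  open import Algebra.Properties.CommutativeSemigroup +-commutativeSemigroup using () renaming (interchange to +-interchange)
  open import Algebra.Properties.CommutativeSemigroup *-commutativeSemigroup using () renaming (interchange to *-interchange)
  open import Relation.Binary.Reasoning.Setoid setoid

  qmul-cong : ∀ {f g} → (∀ i → f i ≈ g i) → ∀ n → qmul f n ≈ qmul g n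
  qmul-cong f≈g zero = refl
  qmul-cong f≈g (suc n) = f≈g n

  qmul-· : ∀ a f n → qmul (a · f) n ≈ a * qmul f n
  qmul-· a f zero = sym (zeroʳ a)
  qmul-· a f (suc n) = refl

  infixl 7 _⋆_
  _⋆_ : PS → PS → PS
  (f ⋆ g) n = sumR (applyUpTo (λ i → f i * g (n ∸ i)) (suc n))

  ⊛≡⋆ : ∀ f g n → (f ⊛ g) n ≡.≡ (f ⋆ g) n
  ⊛≡⋆ f g n = ≡.cong sumR (map-upTo (λ i → f i * g (n ∸ i)) (suc n))

  ⋆-split : ∀ f g n → (f ⋆ g) n ≡.≡ f 0 * g n + qmul ((λ i → f (suc i)) ⋆ g) n
  ⋆-split f g zero = ≡.refl
  ⋆-split f g (suc n) = ≡.refl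

  ⋆-cong≤ : ∀ n {f f′ g g′} → (∀ i → i ≤ n → f i ≈ f′ i) → (∀ i → i ≤ n → g i ≈ g′ i) →
            (f ⋆ g) n ≈ (f′ ⋆ g′) n
  ⋆-cong≤ zero f≈ g≈ = +-congʳ (*-cong (f≈ 0 z≤n) (g≈ 0 z≤n))
  ⋆-cong≤ (suc n) f≈ g≈ =
    +-cong (*-cong (f≈ 0 z≤n) (g≈ (suc n) ℕ.≤-refl))
           (⋆-cong≤ n (λ i i≤n → f≈ (suc i) (s≤s i≤n)) (λ i i≤n → g≈ i (ℕ.m≤n⇒m≤1+n i≤n)))

  ⋆-cong : ∀ n {f f′ g g′} → (∀ i → f i ≈ f′ i) → (∀ i → g i ≈ g′ i) → (f ⋆ g) n ≈ (f′ ⋆ g′) n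
  ⋆-cong n f≈ g≈ = ⋆-cong≤ n (λ i _ → f≈ i) (λ i _ → g≈ i)

  ⋆-zeroˡ : ∀ n {f} g → (∀ i → f i ≈ 0#) → (f ⋆ g) n ≈ 0#
  ⋆-zeroˡ zero g f≈0 = trans (+-identityʳ _) (trans (*-congʳ (f≈0 0)) (zeroˡ _))
  ⋆-zeroˡ (suc n) g f≈0 =
    trans (+-cong (trans (*-congʳ (f≈0 0)) (zeroˡ _)) (⋆-zeroˡ n g (λ i → f≈0 (suc i)))) (+-identityˡ _)

  ⋆-constˡ : ∀ n {f} g → (∀ i → f (suc i) ≈ 0#) → (f ⋆ g) n ≈ f 0 * g n
  ⋆-constˡ zero g _ = +-identityʳ _
  ⋆-constˡ (suc n) g f≈0 = trans (+-congˡ (⋆-zeroˡ n g f≈0)) (+-identityʳ _)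

  ⋆-suc-last : ∀ n f g → (f ⋆ g) (suc n) ≈ (f ⋆ (λ i → g (suc i))) n + f (suc n) * g 0
  ⋆-suc-last zero f g = trans (+-congˡ (+-identityʳ _)) (+-congʳ (sym (+-identityʳ _)))
  ⋆-suc-last (suc n) f g = trans (+-congˡ (⋆-suc-last n (λ i → f (suc i)) g)) (sym (+-assoc _ _ _))

  ⋆-comm : ∀ n f g → (f ⋆ g) n ≈ (g ⋆ f) n
  ⋆-comm zero f g = +-congʳ (*-comm _ _)
  ⋆-comm (suc n) f g = begin
    f 0 * g (suc n) + ((λ i → f (suc i)) ⋆ g) n ≈⟨ +-congˡ (⋆-comm n (λ i → f (suc i)) g) ⟩
    f 0 * g (suc n) + (g ⋆ (λ i → f (suc i))) n ≈⟨ +-comm _ _ ⟩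
    (g ⋆ (λ i → f (suc i))) n + f 0 * g (suc n) ≈⟨ +-congˡ (*-comm _ _) ⟩
    (g ⋆ (λ i → f (suc i))) n + g (suc n) * f 0 ≈⟨ ⋆-suc-last n g f ⟨
    (g ⋆ f) (suc n)                             ∎

  ⋆-distribʳ : ∀ n f g h → ((f ⊕ g) ⋆ h) n ≈ (f ⋆ h) n + (g ⋆ h) n
  ⋆-distribʳ zero f g h = begin
    (f 0 + g 0) * h 0 + 0#                 ≈⟨ +-identityʳ _ ⟩
    (f 0 + g 0) * h 0                      ≈⟨ distribʳ _ _ _ ⟩
    f 0 * h 0 + g 0 * h 0                  ≈⟨ +-cong (+-identityʳ _) (+-identityʳ _) ⟨
    (f 0 * h 0 + 0#) + (g 0 * h 0 + 0#)    ∎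
  ⋆-distribʳ (suc n) f g h =
    trans (+-cong (distribʳ _ _ _) (⋆-distribʳ n (λ i → f (suc i)) (λ i → g (suc i)) h))
          (+-interchange _ _ _ _)

  ⋆-distribˡ : ∀ n f g h → (f ⋆ (g ⊕ h)) n ≈ (f ⋆ g) n + (f ⋆ h) n
  ⋆-distribˡ n f g h =
    trans (⋆-comm n f (g ⊕ h)) (trans (⋆-distribʳ n g h f) (+-cong (⋆-comm n g f) (⋆-comm n h f)))

  ⋆-·ˡ : ∀ n a f g → ((a · f) ⋆ g) n ≈ a * (f ⋆ g) n
  ⋆-·ˡ zero a f g = trans (+-identityʳ _) (trans (*-assoc _ _ _) (*-congˡ (sym (+-identityʳ _))))
  ⋆-·ˡ (suc n) a f g =
    trans (+-cong (*-assoc _ _ _) (⋆-·ˡ n a (λ i → f (suc i)) g)) (sym (distribˡ _ _ _))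

  ⋆-·ʳ : ∀ n a f g → (f ⋆ (a · g)) n ≈ a * (f ⋆ g) n
  ⋆-·ʳ n a f g = trans (⋆-comm n f (a · g)) (trans (⋆-·ˡ n a g f) (*-congˡ (⋆-comm n g f)))

  ⋆-qmulˡ : ∀ n f g → (qmul f ⋆ g) n ≈ qmul (f ⋆ g) n
  ⋆-qmulˡ zero f g = trans (+-identityʳ _) (zeroˡ _)
  ⋆-qmulˡ (suc n) f g = trans (+-congʳ (zeroˡ _)) (+-identityˡ _)

  ⋆-qmulʳ : ∀ n f g → (f ⋆ qmul g) n ≈ qmul (f ⋆ g) n
  ⋆-qmulʳ n f g = trans (⋆-comm n f (qmul g)) (trans (⋆-qmulˡ n g f) (qmul-cong (λ k → ⋆-comm k g f) n))

  ⋆-head+tail : ∀ f a b g h → f 0 ≈ a → (∀ i → f (suc i) ≈ b * g i) →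
                ∀ n → (f ⋆ h) n ≈ a * h n + b * qmul (g ⋆ h) n
  ⋆-head+tail f a b g h f₀ f-suc n = begin
    (f ⋆ h) n                                   ≡⟨ ⋆-split f h n ⟩
    f 0 * h n + qmul ((λ i → f (suc i)) ⋆ h) n  ≈⟨ +-cong (*-congʳ f₀) (qmul-cong tail n) ⟩
    a * h n + qmul (b · (g ⋆ h)) n              ≈⟨ +-congˡ (qmul-· b (g ⋆ h) n) ⟩
    a * h n + b * qmul (g ⋆ h) n                ∎
    where
    tail : ∀ k → ((λ i → f (suc i)) ⋆ h) k ≈ b * (g ⋆ h) k
    tail k = trans (⋆-cong k {g = h} {g′ = h} f-suc (λ _ → refl)) (⋆-·ˡ k b g h)

  ⋆-qmul²ʳ : ∀ n f g → (f ⋆ qmul (qmul g)) n ≈ qmul (qmul (f ⋆ g)) n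
  ⋆-qmul²ʳ n f g = trans (⋆-qmulʳ n f (qmul g)) (qmul-cong (λ k → ⋆-qmulʳ k f g) n)

  poly₃-⋆ : ∀ a b c g n → (poly (a ∷ b ∷ c ∷ []) ⋆ g) n ≈ a * g n + b * qmul g n + c * qmul (qmul g) n
  poly₃-⋆ a b c g 0 =
    solve 4 (λ a b c g₀ → a :* g₀ :+ con (+ 0) := a :* g₀ :+ b :* con (+ 0) :+ c :* con (+ 0)) refl a b c (g 0)
  poly₃-⋆ a b c g 1 =
    solve 5 (λ a b c g₀ g₁ → a :* g₁ :+ (b :* g₀ :+ con (+ 0)) := a :* g₁ :+ b :* g₀ :+ c :* con (+ 0))
            refl a b c (g 0) (g 1)
  poly₃-⋆ a b c g (suc (suc n)) = begin
    a * g (2 ℕ.+ n) + (b * g (1 ℕ.+ n) + (poly (c ∷ []) ⋆ g) n)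
      ≈⟨ +-congˡ (+-congˡ (⋆-constˡ n {poly (c ∷ [])} g (λ _ → refl))) ⟩
    a * g (2 ℕ.+ n) + (b * g (1 ℕ.+ n) + c * g n)
      ≈⟨ +-assoc _ _ _ ⟨
    a * g (2 ℕ.+ n) + b * g (1 ℕ.+ n) + c * g n
      ∎

  ⋆-binomial : ∀ n a b y → ((a ⊕ (y · b)) ⋆ (a ⊕ (y · b))) n ≈
               (a ⋆ a) n + y * (a ⋆ b) n + y * (b ⋆ a) n + y * y * (b ⋆ b) n
  ⋆-binomial n a b y = begin
    ((a ⊕ (y · b)) ⋆ s) n
      ≈⟨ ⋆-distribʳ n a (y · b) s ⟩
    (a ⋆ s) n + ((y · b) ⋆ s) n
      ≈⟨ +-cong (⋆-distribˡ n a a (y · b)) (⋆-·ˡ n y b s) ⟩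
    ((a ⋆ a) n + (a ⋆ (y · b)) n) + y * (b ⋆ s) n
      ≈⟨ +-cong (+-congˡ (⋆-·ʳ n y a b)) (*-congˡ (trans (⋆-distribˡ n b a (y · b)) (+-congˡ (⋆-·ʳ n y b b)))) ⟩
    ((a ⋆ a) n + y * (a ⋆ b) n) + y * ((b ⋆ a) n + y * (b ⋆ b) n)
      ≈⟨ solve 5 (λ aa ab ba bb y → (aa :+ y :* ab) :+ y :* (ba :+ y :* bb) := aa :+ y :* ab :+ y :* ba :+ y :* y :* bb)
                 refl ((a ⋆ a) n) ((a ⋆ b) n) ((b ⋆ a) n) ((b ⋆ b) n) y ⟩
    (a ⋆ a) n + y * (a ⋆ b) n + y * (b ⋆ a) n + y * y * (b ⋆ b) n ∎
    where
    s : PS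
    s = a ⊕ (y · b)

  sumMap : {A : Set} → (A → Carrier) → List A → Carrier
  sumMap Φ xs = sumR (map Φ xs)

  sumMap-cong : {A : Set} (xs : List A) {Φ Ψ : A → Carrier} → (∀ x → Φ x ≈ Ψ x) → sumMap Φ xs ≈ sumMap Ψ xs
  sumMap-cong [] Φ≈Ψ = refl
  sumMap-cong (x ∷ xs) Φ≈Ψ = +-cong (Φ≈Ψ x) (sumMap-cong xs Φ≈Ψ)

  sumMap-++ : {A : Set} (Φ : A → Carrier) (xs ys : List A) → sumMap Φ (xs ++ ys) ≈ sumMap Φ xs + sumMap Φ ys
  sumMap-++ Φ [] ys = sym (+-identityˡ _)
  sumMap-++ Φ (x ∷ xs) ys = trans (+-congˡ (sumMap-++ Φ xs ys)) (sym (+-assoc _ _ _))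

  sumMap-concatMap : {A B : Set} (Φ : B → Carrier) (h : A → List B) (xs : List A) →
                     sumMap Φ (concatMap h xs) ≈ sumMap (λ x → sumMap Φ (h x)) xs
  sumMap-concatMap Φ h [] = refl
  sumMap-concatMap Φ h (x ∷ xs) = trans (sumMap-++ Φ (h x) (concatMap h xs)) (+-congˡ (sumMap-concatMap Φ h xs))

  sumMap-map : {A B : Set} (Φ : B → Carrier) (h : A → B) (xs : List A) → sumMap Φ (map h xs) ≡.≡ sumMap (λ x → Φ (h x)) xs
  sumMap-map Φ h [] = ≡.refl
  sumMap-map Φ h (x ∷ xs) = ≡.cong (λ s → Φ (h x) + s) (sumMap-map Φ h xs)

  sumMap-*ˡ : {A : Set} (a : Carrier) (Φ : A → Carrier) (xs : List A) → sumMap (λ x → a * Φ x) xs ≈ a * sumMap Φ xs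
  sumMap-*ˡ a Φ [] = sym (zeroʳ a)
  sumMap-*ˡ a Φ (x ∷ xs) = trans (+-congˡ (sumMap-*ˡ a Φ xs)) (sym (distribˡ _ _ _))

  sumMap-*ʳ : {A : Set} (a : Carrier) (Φ : A → Carrier) (xs : List A) → sumMap (λ x → Φ x * a) xs ≈ sumMap Φ xs * a
  sumMap-*ʳ a Φ [] = sym (zeroˡ a)
  sumMap-*ʳ a Φ (x ∷ xs) = trans (+-congˡ (sumMap-*ʳ a Φ xs)) (sym (distribʳ _ _ _))

  sumMap-zero : {A : Set} (xs : List A) → sumMap (λ _ → 0#) xs ≈ 0#
  sumMap-zero [] = refl
  sumMap-zero (x ∷ xs) = trans (+-identityˡ _) (sumMap-zero xs)

  infix 8 [_]·_
  [_]·_ : Bool → Carrier → Carrier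
  [ true ]· x = x
  [ false ]· x = 0#

  []·-cong : ∀ b {x y} → x ≈ y → [ b ]· x ≈ [ b ]· y
  []·-cong true x≈y = x≈y
  []·-cong false x≈y = refl

  []·-*ˡ : ∀ b a x → [ b ]· (a * x) ≈ a * [ b ]· x
  []·-*ˡ true a x = refl
  []·-*ˡ false a x = sym (zeroʳ a)

  []·-∧ : ∀ b b′ x y → [ b ∧ b′ ]· (x * y) ≈ [ b ]· x * [ b′ ]· y
  []·-∧ true true x y = refl
  []·-∧ true false x y = sym (zeroʳ x)
  []·-∧ false b′ x y = sym (zeroˡ _)

  sumMap-filterᵇ : {A : Set} (p : A → Bool) (Φ : A → Carrier) (xs : List A) →
                   sumMap Φ (filterᵇ p xs) ≈ sumMap (λ x → [ p x ]· Φ x) xs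
  sumMap-filterᵇ p Φ [] = refl
  sumMap-filterᵇ p Φ (x ∷ xs) with p x
  ... | true = +-congˡ (sumMap-filterᵇ p Φ xs)
  ... | false = trans (sumMap-filterᵇ p Φ xs) (sym (+-identityˡ _))

  forestSum : (List PTree → Carrier) → PS
  forestSum Φ k = sumMap Φ (forestsF k k)

  forestSum-∷ : ∀ {Φ} φ ψ → (∀ c r → Φ (node c ∷ r) ≈ φ c * ψ r) →
                ∀ k → forestSum Φ (suc k) ≈ (forestSum φ ⋆ forestSum ψ) k
  forestSum-∷ {Φ} φ ψ Φ≈φψ k = begin
    sumMap Φ (concatMap split (upTo (suc k)))
      ≈⟨ sumMap-concatMap Φ split (upTo (suc k)) ⟩
    sumMap (λ j → sumMap Φ (split j)) (upTo (suc k))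
      ≈⟨ sumMap-cong (upTo (suc k)) split-sum ⟩
    sumMap (λ j → sumMap φ (forestsF k j) * sumMap ψ (forestsF k (k ∸ j))) (upTo (suc k))
      ≡⟨ ⊛≡⋆ (λ j → sumMap φ (forestsF k j)) (λ j → sumMap ψ (forestsF k j)) k ⟩
    ((λ j → sumMap φ (forestsF k j)) ⋆ (λ j → sumMap ψ (forestsF k j))) k
      ≈⟨ ⋆-cong≤ k (λ i i≤k → reflexive (≡.cong (sumMap φ) (forestsF-fuel i i≤k ℕ.≤-refl)))
                   (λ i i≤k → reflexive (≡.cong (sumMap ψ) (forestsF-fuel i i≤k ℕ.≤-refl))) ⟩
    (forestSum φ ⋆ forestSum ψ) k ∎
    where
    split : ℕ → List (List PTree)
    split j = concatMap (λ c → map (λ r → node c ∷ r) (forestsF k (k ∸ j))) (forestsF k j)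

    split-sum : ∀ j → sumMap Φ (split j) ≈ sumMap φ (forestsF k j) * sumMap ψ (forestsF k (k ∸ j))
    split-sum j = begin
      sumMap Φ (split j)
        ≈⟨ sumMap-concatMap Φ _ (forestsF k j) ⟩
      sumMap (λ c → sumMap Φ (map (λ r → node c ∷ r) (forestsF k (k ∸ j)))) (forestsF k j)
        ≈⟨ sumMap-cong (forestsF k j) (λ c → reflexive (sumMap-map Φ (λ r → node c ∷ r) (forestsF k (k ∸ j)))) ⟩
      sumMap (λ c → sumMap (λ r → Φ (node c ∷ r)) (forestsF k (k ∸ j))) (forestsF k j)
        ≈⟨ sumMap-cong (forestsF k j) (λ c → trans (sumMap-cong (forestsF k (k ∸ j)) (Φ≈φψ c))
                                                  (sumMap-*ˡ (φ c) ψ (forestsF k (k ∸ j)))) ⟩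
      sumMap (λ c → φ c * sumMap ψ (forestsF k (k ∸ j))) (forestsF k j)
        ≈⟨ sumMap-*ʳ _ φ (forestsF k j) ⟩
      sumMap φ (forestsF k j) * sumMap ψ (forestsF k (k ∸ j)) ∎

  forestSum-vanishing : ∀ {Φ} → (∀ c r → Φ (node c ∷ r) ≈ 0#) → ∀ k → forestSum Φ (suc k) ≈ 0#
  forestSum-vanishing {Φ} Φ≈0 k =
    trans (forestSum-∷ (λ _ → 0#) Φ (λ c r → trans (Φ≈0 c r) (sym (zeroˡ _))) k)
          (⋆-zeroˡ k (forestSum Φ) (λ i → sumMap-zero (forestsF i i)))

  leafIndicator : List PTree → Carrier
  leafIndicator [] = 1#
  leafIndicator (_ ∷ _) = 0#

  forestSum-leaf∷ : ∀ {Φ} a ψ → (∀ c r → Φ (node c ∷ r) ≈ a * (leafIndicator c * ψ r)) →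
                    ∀ k → forestSum Φ (suc k) ≈ a * forestSum ψ k
  forestSum-leaf∷ {Φ} a ψ Φ≈ k = begin
    forestSum Φ (suc k)
      ≈⟨ forestSum-∷ leading ψ (λ c r → trans (Φ≈ c r) (sym (*-assoc _ _ _))) k ⟩
    (forestSum leading ⋆ forestSum ψ) k
      ≈⟨ ⋆-constˡ k {forestSum leading} (forestSum ψ) (forestSum-vanishing {leading} (λ c r → zeroʳ a)) ⟩
    (a * 1# + 0#) * forestSum ψ k
      ≈⟨ *-congʳ (trans (+-identityʳ _) (*-identityʳ a)) ⟩
    a * forestSum ψ k
      ∎
    where
    leading : List PTree → Carrier
    leading c = a * leafIndicator c

  module Weights (u₁ u₂ u₃ v₁ v₂ t : Carrier) where

    monomial : Stats → Carrier
    monomial s = pow u₁ (sleaf s) * pow u₂ (etleaf s) * pow u₃ (entleaf s)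
               * pow v₁ (yerleaf s) * pow v₂ (syleaf s) * pow t (yedge s)

    -- The same monomial in solver syntax: for concrete statistics its semantics is definitionally
    -- monomial s, so `solve` evaluates monomials of concrete statistics.
    monomialᴾ : ∀ {n} → Stats → (u₁ u₂ u₃ v₁ v₂ t : Polynomial n) → Polynomial n
    monomialᴾ s u₁ u₂ u₃ v₁ v₂ t = u₁ :^ sleaf s :* u₂ :^ etleaf s :* u₃ :^ entleaf s
                                 :* v₁ :^ yerleaf s :* v₂ :^ syleaf s :* t :^ yedge s

    pow-+ : ∀ x m n → pow x (m ℕ.+ n) ≈ pow x m * pow x n
    pow-+ x zero n = sym (*-identityˡ _)
    pow-+ x (suc m) n = trans (*-congˡ (pow-+ x m n)) (sym (*-assoc _ _ _))

    monomial-⊞ : ∀ a b → monomial (a ⊞ b) ≈ monomial a * monomial b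
    monomial-⊞ a b = trans
      (*-cong (*-cong (*-cong (*-cong (*-cong (pow-+ u₁ (sleaf a) (sleaf b)) (pow-+ u₂ (etleaf a) (etleaf b)))
        (pow-+ u₃ (entleaf a) (entleaf b))) (pow-+ v₁ (yerleaf a) (yerleaf b))) (pow-+ v₂ (syleaf a) (syleaf b)))
        (pow-+ t (yedge a) (yedge b)))
      (solve 12 (λ a₁ b₁ a₂ b₂ a₃ b₃ a₄ b₄ a₅ b₅ a₆ b₆ →
         a₁ :* b₁ :* (a₂ :* b₂) :* (a₃ :* b₃) :* (a₄ :* b₄) :* (a₅ :* b₅) :* (a₆ :* b₆)
         := a₁ :* a₂ :* a₃ :* a₄ :* a₅ :* a₆ :* (b₁ :* b₂ :* b₃ :* b₄ :* b₅ :* b₆))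
         refl _ _ _ _ _ _ _ _ _ _ _ _)

    monomial-interchange : ∀ w x y z → monomial ((w ⊞ x) ⊞ (y ⊞ z)) ≈ monomial (w ⊞ y) * monomial (x ⊞ z)
    monomial-interchange w x y z = begin
      monomial ((w ⊞ x) ⊞ (y ⊞ z))                           ≈⟨ monomial-⊞ (w ⊞ x) (y ⊞ z) ⟩
      monomial (w ⊞ x) * monomial (y ⊞ z)                    ≈⟨ *-cong (monomial-⊞ w x) (monomial-⊞ y z) ⟩
      (monomial w * monomial x) * (monomial y * monomial z)  ≈⟨ *-interchange _ _ _ _ ⟩
      (monomial w * monomial y) * (monomial x * monomial z)  ≈⟨ *-cong (monomial-⊞ w y) (monomial-⊞ x z) ⟨
      monomial (w ⊞ y) * monomial (x ⊞ z)                    ∎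

    monomial-zeroS : monomial zeroS ≈ 1#
    monomial-zeroS = solve 6 (λ u₁ u₂ u₃ v₁ v₂ t → monomialᴾ zeroS u₁ u₂ u₃ v₁ v₂ t := con (+ 1))
                             refl u₁ u₂ u₃ v₁ v₂ t

    []·-monomial-split : ∀ b b′ w x y z →
      [ b ∧ b′ ]· monomial ((w ⊞ x) ⊞ (y ⊞ z)) ≈ [ b ]· monomial (w ⊞ y) * [ b′ ]· monomial (x ⊞ z)
    []·-monomial-split b b′ w x y z = trans ([]·-cong (b ∧ b′) (monomial-interchange w x y z)) ([]·-∧ b b′ _ _)

    -- siblingsWeight weighs the children after the leading leaf: the first of them carries the
    -- elder twin / non-twin and second-leaf statistics, and youngerWeight weighs the ones after it.
    tipWeight : List PTree → Carrier
    tipWeight cs = [ tipAug (node cs) ]· monomial (treeStats (node cs))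

    childWeight : Carrier → Carrier → List PTree → Carrier
    childWeight a b [] = a
    childWeight a b cs@(_ ∷ _) = b * tipWeight cs

    youngerWeight : List PTree → Carrier
    youngerWeight [] = 1#
    youngerWeight (node c ∷ r) = childWeight (t * v₁) t c * youngerWeight r

    siblingsWeight : List PTree → Carrier
    siblingsWeight [] = u₁
    siblingsWeight (node c ∷ r) = childWeight (u₂ * t * v₂) (u₃ * t) c * youngerWeight r

    childWeight-stats : ∀ {a b} (e : Bool → Stats) → monomial (e true) ≈ a → monomial (e false) ≈ b →
      ∀ c → childWeight a b c ≈ [ tipAug (node c) ]· monomial (e (isLeaf (node c)) ⊞ treeStats (node c))
    childWeight-stats e eᵗ eᶠ [] =
      sym (trans (monomial-⊞ (e true) zeroS) (trans (*-cong eᵗ monomial-zeroS) (*-identityʳ _)))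
    childWeight-stats e eᵗ eᶠ c@(_ ∷ _) =
      sym (trans ([]·-cong (tipAug (node c)) (trans (monomial-⊞ (e false) _) (*-congʳ eᶠ)))
                 ([]·-*ˡ (tipAug (node c)) _ _))

    youngerWeight-stats : ∀ r → youngerWeight r ≈ [ tipAugF r ]· monomial (youngerChildren r ⊞ forestStats r)
    youngerWeight-stats [] = sym monomial-zeroS
    youngerWeight-stats (node c ∷ r) =
      sym (trans ([]·-monomial-split (tipAug (node c)) (tipAugF r)
                   (younger (isLeaf (node c))) (youngerChildren r) (treeStats (node c)) (forestStats r))
                 (*-cong (sym (childWeight-stats younger leaf nonLeaf c)) (sym (youngerWeight-stats r))))
      where
      younger : Bool → Stats
      younger l = stats 0 0 0 0 (b2n l) 1
      leaf : monomial (younger true) ≈ t * v₁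
      leaf = solve 6 (λ u₁ u₂ u₃ v₁ v₂ t → monomialᴾ (younger true) u₁ u₂ u₃ v₁ v₂ t := t :* v₁)
                     refl u₁ u₂ u₃ v₁ v₂ t
      nonLeaf : monomial (younger false) ≈ t
      nonLeaf = solve 6 (λ u₁ u₂ u₃ v₁ v₂ t → monomialᴾ (younger false) u₁ u₂ u₃ v₁ v₂ t := t)
                        refl u₁ u₂ u₃ v₁ v₂ t

    tipWeight-∷ : ∀ c r → tipWeight (node c ∷ r) ≈ leafIndicator c * siblingsWeight r
    tipWeight-∷ (_ ∷ _) r = sym (zeroˡ _)
    tipWeight-∷ [] [] =
      solve 6 (λ u₁ u₂ u₃ v₁ v₂ t → monomialᴾ (stats 1 0 0 0 0 0) u₁ u₂ u₃ v₁ v₂ t := con (+ 1) :* u₁)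
              refl u₁ u₂ u₃ v₁ v₂ t
    tipWeight-∷ [] (node c ∷ r) =
      trans ([]·-monomial-split (tipAug (node c)) (tipAugF r)
               (second (isLeaf (node c))) (youngerChildren r) (treeStats (node c)) (forestStats r))
            (trans (*-cong (sym (childWeight-stats second twin nonTwin c)) (sym (youngerWeight-stats r)))
                   (sym (*-identityˡ _)))
      where
      second : Bool → Stats
      second l = (if l then stats 0 1 0 0 0 0 else stats 0 0 1 0 0 0) ⊞ stats 0 0 0 (b2n l) 0 1
      twin : monomial (second true) ≈ u₂ * t * v₂
      twin = solve 6 (λ u₁ u₂ u₃ v₁ v₂ t → monomialᴾ (second true) u₁ u₂ u₃ v₁ v₂ t := u₂ :* t :* v₂)
                     refl u₁ u₂ u₃ v₁ v₂ t
      nonTwin : monomial (second false) ≈ u₃ * t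
      nonTwin = solve 6 (λ u₁ u₂ u₃ v₁ v₂ t → monomialᴾ (second false) u₁ u₂ u₃ v₁ v₂ t := u₃ :* t)
                        refl u₁ u₂ u₃ v₁ v₂ t

    K : PS
    K = forestSum siblingsWeight

    Z : PS
    Z = forestSum youngerWeight

    childWeight-suc : ∀ a b k → forestSum (childWeight a b) (suc k) ≈ b * K k
    childWeight-suc a b = forestSum-leaf∷ b siblingsWeight (λ c r → *-congˡ (tipWeight-∷ c r))

    K-suc : ∀ n → K (suc n) ≈ (u₂ * t * v₂) * Z n + (u₃ * t) * qmul (K ⋆ Z) n
    K-suc n = trans (forestSum-∷ second youngerWeight (λ c r → refl) n)
                    (⋆-head+tail (forestSum second) _ _ K Z (+-identityʳ _) (childWeight-suc _ _) n)
      where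
      second : List PTree → Carrier
      second = childWeight (u₂ * t * v₂) (u₃ * t)

    Z-suc : ∀ n → Z (suc n) ≈ (t * v₁) * Z n + t * qmul (K ⋆ Z) n
    Z-suc n = trans (forestSum-∷ younger youngerWeight (λ c r → refl) n)
                    (⋆-head+tail (forestSum younger) _ _ K Z (+-identityʳ _) (childWeight-suc _ _) n)
      where
      younger : List PTree → Carrier
      younger = childWeight (t * v₁) t

    M-suc : ∀ n → M u₁ u₂ u₃ v₁ v₂ t (suc n) ≈ K (suc n)
    M-suc n = begin
      sumMap w (filterᵇ tipAug (map node trees))           ≈⟨ sumMap-filterᵇ tipAug w (map node trees) ⟩
      sumMap (λ T → [ tipAug T ]· w T) (map node trees)    ≡⟨ sumMap-map _ node trees ⟩
      forestSum tipWeight (suc (suc n))                    ≈⟨ forestSum-leaf∷ 1# siblingsWeight tip∷ (suc n) ⟩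
      1# * K (suc n)                                       ≈⟨ *-identityˡ _ ⟩
      K (suc n)                                            ∎
      where
      w : PTree → Carrier
      w = weight u₁ u₂ u₃ v₁ v₂ t
      trees : List (List PTree)
      trees = forestsF (suc (suc n)) (suc (suc n))
      tip∷ : ∀ c r → tipWeight (node c ∷ r) ≈ 1# * (leafIndicator c * siblingsWeight r)
      tip∷ c r = trans (tipWeight-∷ c r) (sym (*-identityˡ _))

  module QuadraticEquation
    (u₁ u₂ u₃ v₁ v₂ t t⁻¹ : Carrier) (t*t⁻¹≈1 : t * t⁻¹ ≈ 1#)
    (K Z F : PS)
    (K₀ : K 0 ≈ u₁) (K-suc : ∀ n → K (suc n) ≈ (u₂ * t * v₂) * Z n + (u₃ * t) * qmul (K ⋆ Z) n)
    (Z₀ : Z 0 ≈ 1#) (Z-suc : ∀ n → Z (suc n) ≈ (t * v₁) * Z n + t * qmul (K ⋆ Z) n)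
    (F₀ : F 0 ≈ u₃) (F-suc : ∀ n → F (suc n) ≈ K (suc n))
    where

    W : PS
    W = K ⋆ Z

    t⁻¹-cancel : ∀ x → t⁻¹ * (t * x) ≈ x
    t⁻¹-cancel x = begin
      t⁻¹ * (t * x)  ≈⟨ *-assoc _ _ _ ⟨
      t⁻¹ * t * x    ≈⟨ *-congʳ (trans (*-comm t⁻¹ t) t*t⁻¹≈1) ⟩
      1# * x         ≈⟨ *-identityˡ x ⟩
      x              ∎

    c′ : Carrier
    c′ = t * (u₂ * v₂ − u₃ * v₁)

    F≈u₃Z+c′qZ : ∀ n → F n ≈ u₃ * Z n + c′ * qmul Z n
    F≈u₃Z+c′qZ zero = begin
      F 0                 ≈⟨ F₀ ⟩
      u₃                  ≈⟨ solve 2 (λ u₃ c′ → u₃ := u₃ :* con (+ 1) :+ c′ :* con (+ 0)) refl u₃ c′ ⟩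
      u₃ * 1# + c′ * 0#   ≈⟨ +-congʳ (*-congˡ Z₀) ⟨
      u₃ * Z 0 + c′ * 0#  ∎
    F≈u₃Z+c′qZ (suc n) = begin
      F (suc n)
        ≈⟨ trans (F-suc n) (K-suc n) ⟩
      (u₂ * t * v₂) * Z n + (u₃ * t) * qmul W n
        ≈⟨ solve 7 (λ u₂ u₃ v₁ v₂ t z w →
                      u₂ :* t :* v₂ :* z :+ u₃ :* t :* w
                   := u₃ :* (t :* v₁ :* z :+ t :* w) :+ t :* (u₂ :* v₂ :- u₃ :* v₁) :* z)
                 refl u₂ u₃ v₁ v₂ t (Z n) (qmul W n) ⟩
      u₃ * ((t * v₁) * Z n + t * qmul W n) + c′ * Z n
        ≈⟨ +-congʳ (*-congˡ (Z-suc n)) ⟨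
      u₃ * Z (suc n) + c′ * Z n
        ∎

    K⋆F≈u₃W+c′qW : ∀ n → (K ⋆ F) n ≈ u₃ * W n + c′ * qmul W n
    K⋆F≈u₃W+c′qW n = begin
      (K ⋆ F) n
        ≈⟨ ⋆-cong n {f = K} {g = F} {g′ = (u₃ · Z) ⊕ (c′ · qmul Z)} (λ _ → refl) F≈u₃Z+c′qZ ⟩
      (K ⋆ ((u₃ · Z) ⊕ (c′ · qmul Z))) n
        ≈⟨ ⋆-distribˡ n K (u₃ · Z) (c′ · qmul Z) ⟩
      (K ⋆ (u₃ · Z)) n + (K ⋆ (c′ · qmul Z)) n
        ≈⟨ +-cong (⋆-·ʳ n u₃ K Z) (trans (⋆-·ʳ n c′ K (qmul Z)) (*-congˡ (⋆-qmulʳ n K Z))) ⟩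
      u₃ * W n + c′ * qmul W n
        ∎

    F-suc² : ∀ n → F (suc (suc n)) ≈ t * (v₁ * F (suc n) + (K ⋆ F) n)
    F-suc² n = begin
      F (suc (suc n))
        ≈⟨ F≈u₃Z+c′qZ (suc (suc n)) ⟩
      u₃ * Z (suc (suc n)) + c′ * Z (suc n)
        ≈⟨ +-cong (*-congˡ (Z-suc (suc n))) (*-congˡ (Z-suc n)) ⟩
      u₃ * ((t * v₁) * Z (suc n) + t * W n) + c′ * ((t * v₁) * Z n + t * qmul W n)
        ≈⟨ solve 8 (λ u₃ v₁ t c z₁ z₀ w₁ w₀ →
                      u₃ :* (t :* v₁ :* z₁ :+ t :* w₁) :+ c :* (t :* v₁ :* z₀ :+ t :* w₀)
                   := t :* (v₁ :* (u₃ :* z₁ :+ c :* z₀) :+ (u₃ :* w₁ :+ c :* w₀)))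
                 refl u₃ v₁ t c′ (Z (suc n)) (Z n) (W n) (qmul W n) ⟩
      t * (v₁ * (u₃ * Z (suc n) + c′ * Z n) + (u₃ * W n + c′ * qmul W n))
        ≈⟨ *-congˡ (+-cong (*-congˡ (F≈u₃Z+c′qZ (suc n))) (K⋆F≈u₃W+c′qW n)) ⟨
      t * (v₁ * F (suc n) + (K ⋆ F) n)
        ∎

    K≈F+u₁−u₃ : ∀ n → K n ≈ (F ⊕ poly ((u₁ − u₃) ∷ [])) n
    K≈F+u₁−u₃ zero = begin
      K 0              ≈⟨ K₀ ⟩
      u₁               ≈⟨ solve 2 (λ u₁ u₃ → u₁ := u₃ :+ (u₁ :- u₃)) refl u₁ u₃ ⟩
      u₃ + (u₁ − u₃)   ≈⟨ +-congʳ F₀ ⟨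
      F 0 + (u₁ − u₃)  ∎
    K≈F+u₁−u₃ (suc n) = sym (trans (+-identityʳ _) (F-suc n))

    K⋆F≈F⋆F : ∀ n → (K ⋆ F) n ≈ (F ⋆ F) n + (u₁ − u₃) * F n
    K⋆F≈F⋆F n = begin
      (K ⋆ F) n                                  ≈⟨ ⋆-cong n {g = F} {g′ = F} K≈F+u₁−u₃ (λ _ → refl) ⟩
      ((F ⊕ poly ((u₁ − u₃) ∷ [])) ⋆ F) n        ≈⟨ ⋆-distribʳ n F (poly ((u₁ − u₃) ∷ [])) F ⟩
      (F ⋆ F) n + (poly ((u₁ − u₃) ∷ []) ⋆ F) n  ≈⟨ +-congˡ (⋆-constˡ n {poly ((u₁ − u₃) ∷ [])} F (λ _ → refl)) ⟩
      (F ⋆ F) n + (u₁ − u₃) * F n                ∎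

    t⁻¹F₁ : t⁻¹ * F 1 ≈ u₂ * v₂
    t⁻¹F₁ = begin
      t⁻¹ * F 1
        ≈⟨ *-congˡ (trans (F-suc 0) (K-suc 0)) ⟩
      t⁻¹ * ((u₂ * t * v₂) * Z 0 + (u₃ * t) * 0#)
        ≈⟨ *-congˡ (+-congʳ (*-congˡ Z₀)) ⟩
      t⁻¹ * ((u₂ * t * v₂) * 1# + (u₃ * t) * 0#)
        ≈⟨ *-congˡ (solve 4 (λ u₂ u₃ v₂ t → u₂ :* t :* v₂ :* con (+ 1) :+ u₃ :* t :* con (+ 0) := t :* (u₂ :* v₂))
                            refl u₂ u₃ v₂ t) ⟩
      t⁻¹ * (t * (u₂ * v₂))
        ≈⟨ t⁻¹-cancel _ ⟩
      u₂ * v₂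
        ∎

    A : PS
    A = poly (t⁻¹ ∷ (- v₁) ∷ (u₃ − u₁) ∷ [])

    -- Q = t⁻¹ (u₃ + c′ q)
    Q : PS
    Q = poly (t⁻¹ * u₃ ∷ (u₂ * v₂ − u₃ * v₁) ∷ [])

    S : PS
    S = poly (t⁻¹ ∷ (- v₁) ∷ (u₃ − u₁) ∷ []) ⊖ (two · qmul (qmul F))

    D : PS
    D = poly (t⁻¹ * t⁻¹
             ∷ - (two * t⁻¹ * v₁)
             ∷ (v₁ * v₁ − two * t⁻¹ * (u₁ + u₃))
             ∷ (two * u₁ * v₁ + two * u₃ * v₁ − four * u₂ * v₂)
             ∷ ((u₁ − u₃) * (u₁ − u₃))
             ∷ [])

    quadratic : ∀ n → qmul (qmul (F ⋆ F)) n ≈ (A ⋆ F) n − Q n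
    quadratic 0 = begin
      0#                         ≈⟨ solve 2 (λ t⁻¹ u₃ → con (+ 0) := t⁻¹ :* u₃ :+ con (+ 0) :- t⁻¹ :* u₃)
                                            refl t⁻¹ u₃ ⟩
      t⁻¹ * u₃ + 0# − t⁻¹ * u₃   ≈⟨ +-congʳ (+-congʳ (*-congˡ F₀)) ⟨
      t⁻¹ * F 0 + 0# − t⁻¹ * u₃  ∎
    quadratic 1 = begin
      0#
        ≈⟨ solve 4 (λ u₂ u₃ v₁ v₂ → con (+ 0) := u₂ :* v₂ :+ (:- v₁ :* u₃ :+ con (+ 0)) :- (u₂ :* v₂ :- u₃ :* v₁))
                   refl u₂ u₃ v₁ v₂ ⟩
      u₂ * v₂ + (- v₁ * u₃ + 0#) − (u₂ * v₂ − u₃ * v₁)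
        ≈⟨ +-congʳ (+-cong t⁻¹F₁ (+-congʳ (*-congˡ F₀))) ⟨
      t⁻¹ * F 1 + (- v₁ * F 0 + 0#) − (u₂ * v₂ − u₃ * v₁)
        ∎
    quadratic (suc (suc m)) = sym (begin
      (A ⋆ F) (2 ℕ.+ m) − 0#
        ≈⟨ +-congʳ (poly₃-⋆ t⁻¹ (- v₁) (u₃ − u₁) F (2 ℕ.+ m)) ⟩
      t⁻¹ * F (2 ℕ.+ m) + - v₁ * F (1 ℕ.+ m) + (u₃ − u₁) * F m − 0#
        ≈⟨ +-congʳ (+-congʳ (+-congʳ t⁻¹F)) ⟩
      (v₁ * F (1 ℕ.+ m) + ((F ⋆ F) m + (u₁ − u₃) * F m)) + - v₁ * F (1 ℕ.+ m) + (u₃ − u₁) * F m − 0#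
        ≈⟨ solve 6 (λ v₁ u₁ u₃ f₁ f₀ e →
                      v₁ :* f₁ :+ (e :+ (u₁ :- u₃) :* f₀) :+ :- v₁ :* f₁ :+ (u₃ :- u₁) :* f₀ :- con (+ 0) := e)
                 refl v₁ u₁ u₃ (F (1 ℕ.+ m)) (F m) ((F ⋆ F) m) ⟩
      (F ⋆ F) m ∎)
      where
      t⁻¹F : t⁻¹ * F (2 ℕ.+ m) ≈ v₁ * F (1 ℕ.+ m) + ((F ⋆ F) m + (u₁ − u₃) * F m)
      t⁻¹F = trans (*-congˡ (F-suc² m)) (trans (t⁻¹-cancel _) (+-congˡ (K⋆F≈F⋆F m)))

    discriminant : ∀ m → (A ⋆ A) (2 ℕ.+ m) − four * Q m ≈ D (2 ℕ.+ m)
    discriminant m = trans (+-congʳ (poly₃-⋆ t⁻¹ (- v₁) (u₃ − u₁) A (2 ℕ.+ m))) (coefficients m)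
      where
      coefficients : ∀ m → t⁻¹ * A (2 ℕ.+ m) + - v₁ * A (1 ℕ.+ m) + (u₃ − u₁) * A m − four * Q m ≈ D (2 ℕ.+ m)
      coefficients 0 = solve 4 (λ t⁻¹ v₁ u₁ u₃ →
          t⁻¹ :* (u₃ :- u₁) :+ :- v₁ :* :- v₁ :+ (u₃ :- u₁) :* t⁻¹ :- (con (+ 2) :+ con (+ 2)) :* (t⁻¹ :* u₃)
        := v₁ :* v₁ :- con (+ 2) :* t⁻¹ :* (u₁ :+ u₃)) refl t⁻¹ v₁ u₁ u₃
      coefficients 1 = solve 6 (λ t⁻¹ v₁ u₁ u₃ u₂ v₂ →
          t⁻¹ :* con (+ 0) :+ :- v₁ :* (u₃ :- u₁) :+ (u₃ :- u₁) :* :- v₁ :- (con (+ 2) :+ con (+ 2)) :* (u₂ :* v₂ :- u₃ :* v₁)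
        := con (+ 2) :* u₁ :* v₁ :+ con (+ 2) :* u₃ :* v₁ :- (con (+ 2) :+ con (+ 2)) :* u₂ :* v₂)
        refl t⁻¹ v₁ u₁ u₃ u₂ v₂
      coefficients 2 = solve 4 (λ t⁻¹ v₁ u₁ u₃ →
          t⁻¹ :* con (+ 0) :+ :- v₁ :* con (+ 0) :+ (u₃ :- u₁) :* (u₃ :- u₁) :- (con (+ 2) :+ con (+ 2)) :* con (+ 0)
        := (u₁ :- u₃) :* (u₁ :- u₃)) refl t⁻¹ v₁ u₁ u₃
      coefficients (suc (suc (suc k))) = solve 4 (λ t⁻¹ v₁ u₁ u₃ →
          t⁻¹ :* con (+ 0) :+ :- v₁ :* con (+ 0) :+ (u₃ :- u₁) :* con (+ 0) :- (con (+ 2) :+ con (+ 2)) :* con (+ 0)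
        := con (+ 0)) refl t⁻¹ v₁ u₁ u₃

    S₀ : S 0 ≈ t⁻¹
    S₀ = solve 1 (λ t⁻¹ → t⁻¹ :+ :- (con (+ 2) :* con (+ 0)) := t⁻¹) refl t⁻¹

    square : ∀ n → (S ⋆ S) n ≈ D n
    square 0 = trans (+-identityʳ _) (*-cong S₀ S₀)
    square 1 = solve 2 (λ t⁻¹ v₁ →
        (t⁻¹ :+ :- (con (+ 2) :* con (+ 0))) :* (:- v₁ :+ :- (con (+ 2) :* con (+ 0)))
        :+ ((:- v₁ :+ :- (con (+ 2) :* con (+ 0))) :* (t⁻¹ :+ :- (con (+ 2) :* con (+ 0))) :+ con (+ 0))
      := :- (con (+ 2) :* t⁻¹ :* v₁)) refl t⁻¹ v₁
    square (suc (suc m)) = begin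
      (S ⋆ S) (2 ℕ.+ m)
        ≈⟨ ⋆-cong (2 ℕ.+ m) S≈ S≈ ⟩
      ((A ⊕ ((- two) · G)) ⋆ (A ⊕ ((- two) · G))) (2 ℕ.+ m)
        ≈⟨ ⋆-binomial (2 ℕ.+ m) A G (- two) ⟩
      (A ⋆ A) (2 ℕ.+ m) + - two * (A ⋆ G) (2 ℕ.+ m) + - two * (G ⋆ A) (2 ℕ.+ m) + - two * - two * (G ⋆ G) (2 ℕ.+ m)
        ≈⟨ +-cong (+-cong (+-congˡ (*-congˡ A⋆G)) (*-congˡ (trans (⋆-comm (2 ℕ.+ m) G A) A⋆G))) (*-congˡ G⋆G) ⟩
      (A ⋆ A) (2 ℕ.+ m) + - two * (A ⋆ F) m + - two * (A ⋆ F) m + - two * - two * ((A ⋆ F) m − Q m)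
        ≈⟨ solve 3 (λ a y q →
                      a :+ :- con (+ 2) :* y :+ :- con (+ 2) :* y :+ :- con (+ 2) :* :- con (+ 2) :* (y :- q)
                   := a :- (con (+ 2) :+ con (+ 2)) :* q)
                 refl ((A ⋆ A) (2 ℕ.+ m)) ((A ⋆ F) m) (Q m) ⟩
      (A ⋆ A) (2 ℕ.+ m) − four * Q m
        ≈⟨ discriminant m ⟩
      D (2 ℕ.+ m) ∎
      where
      G : PS
      G = qmul (qmul F)
      S≈ : ∀ i → S i ≈ (A ⊕ ((- two) · G)) i
      S≈ i = +-congˡ (-‿distribˡ-* two (G i))
      A⋆G : (A ⋆ G) (2 ℕ.+ m) ≈ (A ⋆ F) m
      A⋆G = trans (⋆-qmulʳ (2 ℕ.+ m) A (qmul F)) (⋆-qmulʳ (1 ℕ.+ m) A F)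
      G⋆G : (G ⋆ G) (2 ℕ.+ m) ≈ (A ⋆ F) m − Q m
      G⋆G = trans (⋆-qmulˡ (2 ℕ.+ m) (qmul F) G)
                  (trans (⋆-qmulˡ (1 ℕ.+ m) F G) (trans (⋆-qmul²ʳ m F F) (quadratic m)))

theorem4p2 : {c ℓ : Level} (R : CommutativeRing c ℓ) →
  let open CommutativeRing R
      open Series R
  in (u₁ u₂ u₃ v₁ v₂ t t⁻¹ : Carrier) → t * t⁻¹ ≈ 1# →
     let F : PS
         F = M u₁ u₂ u₃ v₁ v₂ t
         S : PS
         S = poly (t⁻¹ ∷ (- v₁) ∷ (u₃ − u₁) ∷ []) ⊖ (two · qmul (qmul F))
         D : PS
         D = poly (t⁻¹ * t⁻¹
                  ∷ - (two * t⁻¹ * v₁)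
                  ∷ (v₁ * v₁ − two * t⁻¹ * (u₁ + u₃))
                  ∷ (two * u₁ * v₁ + two * u₃ * v₁ − four * u₂ * v₂)
                  ∷ ((u₁ − u₃) * (u₁ − u₃))
                  ∷ [])
     in (S 0 ≈ t⁻¹) × ((n : ℕ) → (S ⊛ S) n ≈ D n)
theorem4p2 R u₁ u₂ u₃ v₁ v₂ t t⁻¹ t*t⁻¹≈1 = S₀ , λ n → trans (reflexive (⊛≡⋆ R S S n)) (square n)
  where
  open CommutativeRing R using (1#; refl; trans; reflexive; +-identityʳ)
  open Weights R u₁ u₂ u₃ v₁ v₂ t
  open QuadraticEquation R u₁ u₂ u₃ v₁ v₂ t t⁻¹ t*t⁻¹≈1 K Z (Series.M R u₁ u₂ u₃ v₁ v₂ t)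
         (+-identityʳ u₁) K-suc (+-identityʳ 1#) Z-suc refl M-suc
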